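{- Let $n, m$ be integers with $n \geq m \geq 2$. Let $r$ be the remainder when $n-m$ is divided by $m-1$ if $n \neq m$, and let $r = 0$ if $n = m$. Then $$F(P_n \square P_m) \geq \begin{cases} nm-n, & \text{if } r = 0,\\ nm-n-m+2, & \text{if } r \neq 0.\end{cases}$$
   Context: All graphs are simple, finite and undirected; $P_k$ is the path on $k$ vertices. The Cartesian product $G \square H$ has vertex set $V(G)\times V(H)$, with $(u,v)$ adjacent to $(u',v')$ iff either $u=u'$ and $vv'\in E(H)$, or $v=v'$ and $uu'\in E(G)$. Zero forcing: each vertex is blue or white; starting from an initial set $S$ of blue vertices, repeatedly apply the color-change rule: if a blue vertex $u$ has exactly one white neighbor $v$, color $v$ blue. $S$ is a zero forcing set if eventually all vertices are blue, and a failed zero forcing set otherwise. $F(G)$ denotes the maximum cardinality of a failed zero forcing set of $G$. -}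

module Defs where

open import Data.Nat using (ℕ; zero; suc; _+_; _*_; _∸_; _≤_)
open import Data.Nat.DivMod using (_%_)
open import Data.Fin using (Fin; toℕ; remQuot)
open import Data.Fin.Subset using (Subset; _∈_; ∣_∣)
open import Data.Product using (_×_; _,_; proj₁; proj₂; ∃-syntax)
open import Data.Sum using (_⊎_)
open import Relation.Binary.PropositionalEquality using (_≡_; _≢_)
open import Relation.Nullary using (¬_)

record Graph : Set₁ where
  field
    N     : ℕ
    Adj   : Fin N → Fin N → Set
    sym   : ∀ {u v} → Adj u v → Adj v u
    irrefl : ∀ {u} → ¬ Adj u u

open Graph public

PathAdj : (k : ℕ) → Fin k → Fin k → Set
PathAdj k i j = (suc (toℕ i) ≡ toℕ j) ⊎ (suc (toℕ j) ≡ toℕ i)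

private
  suc≢ : ∀ (a : ℕ) → ¬ (suc a ≡ a)
  suc≢ zero ()
  suc≢ (suc a) p = suc≢ a (Data.Nat.Properties.suc-injective p)
    where import Data.Nat.Properties

  pathIrr : ∀ {k} {i : Fin k} → ¬ PathAdj k i i
  pathIrr {i = i} (Data.Sum.inj₁ p) = suc≢ (toℕ i) p
  pathIrr {i = i} (Data.Sum.inj₂ p) = suc≢ (toℕ i) p

  pathSym : ∀ {k} {i j : Fin k} → PathAdj k i j → PathAdj k j i
  pathSym (Data.Sum.inj₁ p) = Data.Sum.inj₂ p
  pathSym (Data.Sum.inj₂ p) = Data.Sum.inj₁ p

P : ℕ → Graph
P k = record { N = k ; Adj = PathAdj k ; sym = pathSym ; irrefl = pathIrr }

-- Cartesian product G □ H; the vertex (u , v) is encoded in Fin (N G * N H)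
-- via Data.Fin.combine / remQuot (a bijection Fin a × Fin b ≃ Fin (a * b)).
ProdAdj : (G H : Graph) → Fin (N G * N H) → Fin (N G * N H) → Set
ProdAdj G H x y =
  let (u  , v)  = remQuot {N G} (N H) x
      (u' , v') = remQuot {N G} (N H) y
  in (u ≡ u' × Adj H v v') ⊎ (v ≡ v' × Adj G u u')

private
  prodSym : ∀ {G H} {x y} → ProdAdj G H x y → ProdAdj G H y x
  prodSym {G} {H} (Data.Sum.inj₁ (e , a)) =
    Data.Sum.inj₁ (Relation.Binary.PropositionalEquality.sym e , Graph.sym H a)
  prodSym {G} {H} (Data.Sum.inj₂ (e , a)) =
    Data.Sum.inj₂ (Relation.Binary.PropositionalEquality.sym e , Graph.sym G a)

  prodIrr : ∀ {G H} {x} → ¬ ProdAdj G H x x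
  prodIrr {G} {H} (Data.Sum.inj₁ (_ , a)) = Graph.irrefl H a
  prodIrr {G} {H} (Data.Sum.inj₂ (_ , a)) = Graph.irrefl G a

_□_ : Graph → Graph → Graph
G □ H = record { N = N G * N H ; Adj = ProdAdj G H ; sym = prodSym {G} {H} ; irrefl = prodIrr {G} {H} }

-- The set of vertices that are eventually blue when starting from S
-- (the closure of S under the color-change rule; this closure is
-- independent of the order in which forces are performed).
data Blue (G : Graph) (S : Subset (N G)) : Fin (N G) → Set where
  initial : ∀ {v} → v ∈ S → Blue G S v
  force   : ∀ {u v} → Blue G S u → Adj G u v
          → (∀ w → Adj G u w → w ≢ v → Blue G S w)
          → Blue G S v

ZeroForcingSet : (G : Graph) → Subset (N G) → Set
ZeroForcingSet G S = ∀ v → Blue G S v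

FailedZeroForcingSet : (G : Graph) → Subset (N G) → Set
FailedZeroForcingSet G S = ¬ ZeroForcingSet G S

-- "F(G) ≥ k": since F(G) is the maximum cardinality of a failed zero forcing
-- set, F(G) ≥ k holds iff some failed zero forcing set has cardinality ≥ k.
F≥ : Graph → ℕ → Set
F≥ G k = ∃[ S ] (FailedZeroForcingSet G S × k ≤ ∣ S ∣)

r : ℕ → ℕ → ℕ
r n zero = 0
r n (suc zero) = 0
r n (suc (suc k)) with n Data.Nat.≟ suc (suc k)
... | Relation.Nullary.yes _ = 0
... | Relation.Nullary.no _ = (n ∸ suc (suc k)) % suc k

bound : ℕ → ℕ → ℕ
bound n m with r n m
... | zero  = n * m ∸ n
... | suc _ = n * m ∸ n ∸ m + 2

-- The white set is a billiard trajectory: a point moving diagonally through the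
-- (n × m) grid and reflecting off its sides. A neighbour of a point of the
-- trajectory differs from it in one coordinate only, so it is also adjacent to
-- the previous or the next point of the trajectory. Hence, once the trajectory
-- revisits an earlier cell after N steps, its first N cells form a fort (every
-- vertex outside has no neighbour or at least two neighbours in it), and the
-- complement of a fort is a failed zero forcing set of size nm − N. If m − 1
-- divides n − 1, the trajectory reaches a corner after n − 1 steps and retraces
-- itself, giving N = n; otherwise, writing n − 1 = (m − 1) + c, it returns to
-- the cell reached after c steps at time (n − 1) + (m − 1), giving N = n + m − 2.
module Submission where

open import Data.Nat
  using (ℕ; zero; suc; pred; _+_; _*_; _∸_; _≤_; _<_; _≟_; _≤?_; z≤n; s≤s)
open import Data.Nat.Properties
open import Data.Nat.Divisibility using (_∣_; divides; ∣-refl; ∣-reflexive; m%n≡0⇒n∣m; ∣m∸n∣n⇒∣m)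
open import Data.Nat.Tactic.RingSolver using (solve-∀)
open import Data.Fin using (Fin; toℕ; fromℕ<; combine; remQuot)
open import Data.Fin.Properties
  using (toℕ-injective; toℕ-fromℕ<; toℕ≤pred[n]; remQuot-combine; combine-injectiveˡ)
open import Data.Fin.Subset using (Subset; _∈_; _∉_; ∣_∣; ⁅_⁆; _∪_; ∁; inside; outside)
  renaming (⊥ to ∅)
open import Data.Fin.Subset.Properties
  using (∉⊥; x∈⁅x⁆; x∈⁅y⁆⇒x≡y; x∈p∪q⁻; p⊆p∪q; q⊆p∪q; ∣⊥∣≡0; ∣⁅x⁆∣≡1; x∈∁p⇒x∉p; ∣∁p∣≡n∸∣p∣)
open import Data.Vec using ([]; _∷_)
open import Data.Product using (_×_; _,_; proj₁; proj₂; ∃-syntax)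
open import Data.Sum using (_⊎_; inj₁; inj₂)
open import Relation.Nullary using (¬_; yes; no; contradiction)
open import Relation.Binary.PropositionalEquality
  using (_≡_; _≢_; refl; sym; trans; cong; cong₂; subst; subst₂; module ≡-Reasoning)

open import Defs hiding (sym)

infix 4 _~_
_~_ : ℕ → ℕ → Set
x ~ y = suc x ≡ y ⊎ suc y ≡ x

data Heading : Set where
  rising falling : Heading

State : Set
State = ℕ × Heading

move : ℕ → State → State
move w (c , rising) with suc c ≤? w
... | yes _ = suc c , rising
... | no _  = pred c , falling
move w (zero  , falling) = 1 , rising
move w (suc c , falling) = c , falling

-- A state is a position together with the direction of the last step. The
-- walk starts at 0 as if it had just come down from 1, so zigzag w runs
-- 0, 1, …, w, w − 1, …, 0, 1, … (the triangle wave of period 2w) and the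
-- predecessor of position 0 at time 0 is zigzag w 1.
orbit : ℕ → ℕ → State
orbit w zero    = 0 , falling
orbit w (suc k) = move w (orbit w k)

zigzag : ℕ → ℕ → ℕ
zigzag w k = proj₁ (orbit w k)

previous : State → ℕ
previous (c , rising)  = pred c
previous (c , falling) = suc c

Valid : ℕ → State → Set
Valid w (c , rising)  = 1 ≤ c × c ≤ w
Valid w (c , falling) = c < w

move-rising : ∀ {w c} → suc c ≤ w → move w (c , rising) ≡ (suc c , rising)
move-rising {w} {c} c<w with suc c ≤? w
... | yes _   = refl
... | no c≮w = contradiction c<w c≮w

move-turning : ∀ {w c} → ¬ suc c ≤ w → move w (c , rising) ≡ (pred c , falling)
move-turning {w} {c} c≮w with suc c ≤? w
... | yes c<w = contradiction c<w c≮w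
... | no _    = refl

position≤ : ∀ {w} s → Valid w s → proj₁ s ≤ w
position≤ (c , rising)  (_ , c≤w) = c≤w
position≤ (c , falling) c<w       = <⇒≤ c<w

move-valid : ∀ {w} s → Valid w s → Valid w (move w s)
move-valid {w} (suc c , rising) _ with suc (suc c) ≤? w
... | yes c+1<w = s≤s z≤n , c+1<w
move-valid (suc c , rising) (_ , c<w) | no _ = c<w
move-valid (zero  , falling) 0<w   = s≤s z≤n , 0<w
move-valid (suc c , falling) c+1<w = <⇒≤ c+1<w

move-adjacent : ∀ {w} s → Valid w s → proj₁ s ~ proj₁ (move w s)
move-adjacent {w} (suc c , rising) _ with suc (suc c) ≤? w
... | yes _ = inj₁ refl
... | no _  = inj₂ refl
move-adjacent (zero  , falling) _ = inj₁ refl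
move-adjacent (suc c , falling) _ = inj₂ refl

previous-move : ∀ {w} s → Valid w s → previous (move w s) ≡ proj₁ s
previous-move {w} (suc c , rising) _ with suc (suc c) ≤? w
... | yes _ = refl
... | no _  = refl
previous-move (zero  , falling) _ = refl
previous-move (suc c , falling) _ = refl

move-covers : ∀ {w} s → Valid w s → ∀ {z} → z ≤ w → z ~ proj₁ s →
              z ≡ previous s ⊎ z ≡ proj₁ (move w s)
move-covers (suc c , rising) _ _ (inj₁ z+1≡c+1) = inj₁ (suc-injective z+1≡c+1)
move-covers {w} (suc c , rising) _ z≤w (inj₂ refl) with suc (suc c) ≤? w
... | yes _   = inj₂ refl
... | no c≮w = contradiction z≤w c≮w
move-covers (suc c , falling) _ _ (inj₁ refl) = inj₂ refl
move-covers (_     , falling) _ _ (inj₂ refl) = inj₁ refl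

orbit-valid : ∀ {w} → 1 ≤ w → ∀ k → Valid w (orbit w k)
orbit-valid 1≤w zero    = 1≤w
orbit-valid 1≤w (suc k) = move-valid _ (orbit-valid 1≤w k)

zigzag≤ : ∀ {w} → 1 ≤ w → ∀ k → zigzag w k ≤ w
zigzag≤ 1≤w k = position≤ _ (orbit-valid 1≤w k)

zigzag-adjacent : ∀ {w} → 1 ≤ w → ∀ k → zigzag w k ~ zigzag w (suc k)
zigzag-adjacent 1≤w k = move-adjacent _ (orbit-valid 1≤w k)

zigzag-neighbours : ∀ {w} → 1 ≤ w → ∀ k {z} → z ≤ w → z ~ zigzag w k →
                    z ≡ zigzag w (suc k) ⊎ ∃[ j ] (k ≡ suc j × z ≡ zigzag w j)
zigzag-neighbours 1≤w zero z≤w z~ with move-covers _ 1≤w z≤w z~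
... | inj₁ z≡1 = inj₁ z≡1
... | inj₂ z≡1 = inj₁ z≡1
zigzag-neighbours 1≤w (suc j) z≤w z~ with move-covers _ (orbit-valid 1≤w (suc j)) z≤w z~
... | inj₁ z≡prev = inj₂ (j , refl , trans z≡prev (previous-move _ (orbit-valid 1≤w j)))
... | inj₂ z≡next = inj₁ z≡next

orbit-ascending : ∀ {w} k → suc k ≤ w → orbit w (suc k) ≡ (suc k , rising)
orbit-ascending zero    _     = refl
orbit-ascending {w} (suc k) k+1<w =
  trans (cong (move w) (orbit-ascending k (<⇒≤ k+1<w))) (move-rising k+1<w)

zigzag-ascending : ∀ {w} k → k ≤ w → zigzag w k ≡ k
zigzag-ascending zero    _   = refl
zigzag-ascending (suc k) k<w = cong proj₁ (orbit-ascending k k<w)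

orbit-descending : ∀ {w} s t → w ≡ suc (s + t) → orbit w (w + suc s) ≡ (t , falling)
orbit-descending {w} zero t refl = begin
  orbit w (w + 1)         ≡⟨ cong (orbit w) (+-comm w 1) ⟩
  move w (orbit w w)      ≡⟨ cong (move w) (orbit-ascending t ≤-refl) ⟩
  move w (w , rising)     ≡⟨ move-turning 1+n≰n ⟩
  (t , falling)           ∎
  where open ≡-Reasoning
orbit-descending {w} (suc s) t w≡ = begin
  orbit w (w + suc (suc s))     ≡⟨ cong (orbit w) (+-suc w (suc s)) ⟩
  move w (orbit w (w + suc s))  ≡⟨ cong (move w) (orbit-descending s (suc t) (trans w≡ (cong suc (sym (+-suc s t))))) ⟩
  (t , falling)                 ∎
  where open ≡-Reasoning

zigzag-descending : ∀ {w} s t → w ≡ suc (s + t) → zigzag w (w + suc s) ≡ t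
zigzag-descending s t w≡ = cong proj₁ (orbit-descending s t w≡)

orbit-periodic : ∀ {w} → 1 ≤ w → ∀ k → orbit w (k + (w + w)) ≡ orbit w k
orbit-periodic {suc v} _ zero = orbit-descending v 0 (cong suc (sym (+-identityʳ v)))
orbit-periodic {w} 1≤w (suc k) = cong (move w) (orbit-periodic 1≤w k)

zigzag-periodic : ∀ {w} → 1 ≤ w → ∀ k → zigzag w (k + (w + w)) ≡ zigzag w k
zigzag-periodic 1≤w k = cong proj₁ (orbit-periodic 1≤w k)

data AtWall (w : ℕ) : State → Set where
  floor   : AtWall w (0 , falling)
  ceiling : AtWall w (w , rising)

move-at-wall : ∀ {w s} → AtWall w s → proj₁ (move w s) ≡ previous s
move-at-wall floor   = refl
move-at-wall {w} ceiling = cong proj₁ (move-turning {w} 1+n≰n)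

orbit-at-multiple : ∀ {w} → 1 ≤ w → ∀ q → AtWall w (orbit w (q * w))
orbit-at-multiple 1≤w zero = floor
orbit-at-multiple {suc v} _ (suc zero)
  rewrite +-identityʳ v | orbit-ascending {suc v} v ≤-refl = ceiling
orbit-at-multiple {w} 1≤w (suc (suc q)) =
  subst (AtWall w) (sym (trans (cong (orbit w) two-periods-later) (orbit-periodic 1≤w (q * w))))
    (orbit-at-multiple 1≤w q)
  where
  two-periods-later : w + (w + q * w) ≡ q * w + (w + w)
  two-periods-later = trans (sym (+-assoc w w (q * w))) (+-comm (w + w) (q * w))

zigzag-reflects : ∀ {w} → 1 ≤ w → ∀ q k → suc k ≡ q * w → zigzag w (suc (suc k)) ≡ zigzag w k
zigzag-reflects {w} 1≤w q k k+1≡qw = begin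
  zigzag w (suc (suc k))     ≡⟨ move-at-wall (subst (AtWall w) (cong (orbit w) (sym k+1≡qw)) (orbit-at-multiple 1≤w q)) ⟩
  previous (orbit w (suc k)) ≡⟨ previous-move _ (orbit-valid 1≤w k) ⟩
  zigzag w k                 ∎
  where open ≡-Reasoning

Consecutive : ℕ → ℕ → Set
Consecutive k i = i ≡ suc k ⊎ k ≡ suc i

record TightWalk (G : Graph) (f : ℕ → Fin (N G)) : Set where
  field
    adjacent-suc : ∀ k → Adj G (f k) (f (suc k))
    neighbours   : ∀ k {z} → Adj G z (f k) → ∃[ i ] (Consecutive k i × z ≡ f i)

  adjacent-consecutive : ∀ {k i} → Consecutive k i → Adj G (f k) (f i)
  adjacent-consecutive (inj₁ refl) = adjacent-suc _
  adjacent-consecutive (inj₂ refl) = Graph.sym G (adjacent-suc _)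

  consecutive-≢ : ∀ {k i} → Consecutive k i → f i ≢ f k
  consecutive-≢ {k} k~i fi≡fk = irrefl G (subst (Adj G (f k)) fi≡fk (adjacent-consecutive k~i))

open TightWalk

zigzagWalk : ∀ {w} → 1 ≤ w → ℕ → Fin (suc w)
zigzagWalk 1≤w k = fromℕ< (s≤s (zigzag≤ 1≤w k))

toℕ-zigzagWalk : ∀ {w} (1≤w : 1 ≤ w) k → toℕ (zigzagWalk 1≤w k) ≡ zigzag w k
toℕ-zigzagWalk 1≤w k = toℕ-fromℕ< (s≤s (zigzag≤ 1≤w k))

zigzagWalk-≡ : ∀ {w} (1≤w : 1 ≤ w) i j → zigzag w i ≡ zigzag w j → zigzagWalk 1≤w i ≡ zigzagWalk 1≤w j
zigzagWalk-≡ 1≤w i j eq = toℕ-injective (trans (toℕ-zigzagWalk 1≤w i) (trans eq (sym (toℕ-zigzagWalk 1≤w j))))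

zigzagWalk-tight : ∀ {w} (1≤w : 1 ≤ w) → TightWalk (P (suc w)) (zigzagWalk 1≤w)
zigzagWalk-tight {w} 1≤w = record { adjacent-suc = adjacent ; neighbours = neighbours′ }
  where
  toℕ-walk = toℕ-zigzagWalk 1≤w

  adjacent : ∀ k → toℕ (zigzagWalk 1≤w k) ~ toℕ (zigzagWalk 1≤w (suc k))
  adjacent k = subst₂ _~_ (sym (toℕ-walk k)) (sym (toℕ-walk (suc k))) (zigzag-adjacent 1≤w k)

  neighbours′ : ∀ k {z} → toℕ z ~ toℕ (zigzagWalk 1≤w k) →
                ∃[ i ] (Consecutive k i × z ≡ zigzagWalk 1≤w i)
  neighbours′ k {z} z~ with zigzag-neighbours 1≤w k (toℕ≤pred[n] z) (subst (toℕ z ~_) (toℕ-walk k) z~)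
  ... | inj₁ z≡next      = suc k , inj₁ refl , toℕ-injective (trans z≡next (sym (toℕ-walk (suc k))))
  ... | inj₂ (j , refl , z≡prev) = j , inj₂ refl , toℕ-injective (trans z≡prev (sym (toℕ-walk j)))

PairAdj : (G H : Graph) → Fin (N G) × Fin (N H) → Fin (N G) × Fin (N H) → Set
PairAdj G H (x , y) (x′ , y′) = (x ≡ x′ × Adj H y y′) ⊎ (y ≡ y′ × Adj G x x′)

□-adj-combine⁻ : ∀ {G H} {u} x y → Adj (G □ H) u (combine x y) → PairAdj G H (remQuot (N H) u) (x , y)
□-adj-combine⁻ {G} {H} {u} x y = subst (PairAdj G H (remQuot (N H) u)) (remQuot-combine x y)

□-adj-combine⁺ : ∀ {G H} {u} x y → PairAdj G H (remQuot (N H) u) (x , y) → Adj (G □ H) u (combine x y)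
□-adj-combine⁺ {G} {H} {u} x y = subst (PairAdj G H (remQuot (N H) u)) (sym (remQuot-combine x y))

SharedNeighbours : (G : Graph) → (ℕ → Fin (N G)) → Set
SharedNeighbours G c = ∀ k {u} → Adj G u (c k) → ∃[ i ] (Consecutive k i × Adj G u (c i) × c i ≢ c k)

diagonal : ∀ {G H} → (ℕ → Fin (N G)) → (ℕ → Fin (N H)) → ℕ → Fin (N (G □ H))
diagonal f g k = combine (f k) (g k)

diagonal-≢ : ∀ {G H f g} → TightWalk G f → ∀ {k i} → Consecutive k i → diagonal {G} {H} f g i ≢ diagonal {G} {H} f g k
diagonal-≢ tf k~i eq = consecutive-≢ tf k~i (combine-injectiveˡ _ _ _ _ eq)

diagonal-shared : ∀ {G H f g} → TightWalk G f → TightWalk H g → SharedNeighbours (G □ H) (diagonal {G} {H} f g)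
diagonal-shared {G} {H} {f} {g} tf tg k adj with □-adj-combine⁻ {G} {H} (f k) (g k) adj
... | inj₁ (u₁≡fk , u₂~gk) with neighbours tg k u₂~gk
...   | i , k~i , u₂≡gi = i , k~i , u~ci , diagonal-≢ {G} {H} tf k~i
  where
  u~ci = □-adj-combine⁺ {G} {H} (f i) (g i)
           (inj₂ (u₂≡gi , subst (λ x → Adj G x (f i)) (sym u₁≡fk) (adjacent-consecutive tf k~i)))
diagonal-shared {G} {H} {f} {g} tf tg k adj | inj₂ (u₂≡gk , u₁~fk) with neighbours tf k u₁~fk
...   | i , k~i , u₁≡fi = i , k~i , u~ci , diagonal-≢ {G} {H} tf k~i
  where
  u~ci = □-adj-combine⁺ {G} {H} (f i) (g i)
           (inj₁ (u₁≡fi , subst (λ y → Adj H y (g i)) (sym u₂≡gk) (adjacent-consecutive tg k~i)))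

Fort : (G : Graph) → Subset (N G) → Set
Fort G W = (∃[ v ] v ∈ W)
         × (∀ {u v} → u ∉ W → Adj G u v → v ∈ W → ∃[ w ] (Adj G u w × w ≢ v × w ∈ W))

fort-complement-failed : ∀ {G W} → Fort G W → FailedZeroForcingSet G (∁ W)
fort-complement-failed {G} {W} ((v , v∈W) , closed) forced = never-blue (forced v) v∈W
  where
  never-blue : ∀ {x} → Blue G (∁ W) x → x ∉ W
  never-blue (initial x∈∁W) = x∈∁p⇒x∉p x∈∁W
  never-blue (force u-blue u~x others) x∈W with closed (never-blue u-blue) u~x x∈W
  ... | w , u~w , w≢x , w∈W = never-blue (others w u~w w≢x) w∈W

F≥-weaken : ∀ {G k l} → k ≤ l → F≥ G l → F≥ G k
F≥-weaken k≤l (S , failed , l≤∣S∣) = S , failed , ≤-trans k≤l l≤∣S∣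

F≥-fort : ∀ {G W} → Fort G W → F≥ G (N G ∸ ∣ W ∣)
F≥-fort {W = W} fort = ∁ W , fort-complement-failed fort , ≤-reflexive (sym (∣∁p∣≡n∸∣p∣ W))

∣p∪q∣≤∣p∣+∣q∣ : ∀ {n} (p q : Subset n) → ∣ p ∪ q ∣ ≤ ∣ p ∣ + ∣ q ∣
∣p∪q∣≤∣p∣+∣q∣ []            []            = z≤n
∣p∪q∣≤∣p∣+∣q∣ (inside  ∷ p) (inside  ∷ q) = s≤s (≤-trans (m≤n⇒m≤1+n (∣p∪q∣≤∣p∣+∣q∣ p q)) (≤-reflexive (sym (+-suc _ _))))
∣p∪q∣≤∣p∣+∣q∣ (inside  ∷ p) (outside ∷ q) = s≤s (∣p∪q∣≤∣p∣+∣q∣ p q)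
∣p∪q∣≤∣p∣+∣q∣ (outside ∷ p) (inside  ∷ q) = ≤-trans (s≤s (∣p∪q∣≤∣p∣+∣q∣ p q)) (≤-reflexive (sym (+-suc _ _)))
∣p∪q∣≤∣p∣+∣q∣ (outside ∷ p) (outside ∷ q) = ∣p∪q∣≤∣p∣+∣q∣ p q

imageBelow : ∀ {n} → (ℕ → Fin n) → ℕ → Subset n
imageBelow c zero    = ∅
imageBelow c (suc j) = ⁅ c j ⁆ ∪ imageBelow c j

∈-imageBelow⁺ : ∀ {n} (c : ℕ → Fin n) {k j} → k < j → c k ∈ imageBelow c j
∈-imageBelow⁺ c {k} {suc j} k<j+1 with m≤n⇒m<n∨m≡n (≤-pred k<j+1)
... | inj₁ k<j  = q⊆p∪q ⁅ c j ⁆ (imageBelow c j) (∈-imageBelow⁺ c k<j)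
... | inj₂ refl = p⊆p∪q (imageBelow c j) (x∈⁅x⁆ (c k))

∈-imageBelow⁻ : ∀ {n} (c : ℕ → Fin n) j {x} → x ∈ imageBelow c j → ∃[ k ] (k < j × x ≡ c k)
∈-imageBelow⁻ c zero    x∈ = contradiction x∈ ∉⊥
∈-imageBelow⁻ c (suc j) x∈ with x∈p∪q⁻ ⁅ c j ⁆ (imageBelow c j) x∈
... | inj₁ x∈⁅cj⁆ = j , ≤-refl , x∈⁅y⁆⇒x≡y (c j) x∈⁅cj⁆
... | inj₂ x∈rest with ∈-imageBelow⁻ c j x∈rest
...   | k , k<j , x≡ck = k , m≤n⇒m≤1+n k<j , x≡ck

∣imageBelow∣≤ : ∀ {n} (c : ℕ → Fin n) j → ∣ imageBelow c j ∣ ≤ j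
∣imageBelow∣≤ {n} c zero    = ≤-reflexive (∣⊥∣≡0 n)
∣imageBelow∣≤     c (suc j) = begin
  ∣ ⁅ c j ⁆ ∪ imageBelow c j ∣          ≤⟨ ∣p∪q∣≤∣p∣+∣q∣ ⁅ c j ⁆ (imageBelow c j) ⟩
  ∣ ⁅ c j ⁆ ∣ + ∣ imageBelow c j ∣      ≡⟨ cong (_+ ∣ imageBelow c j ∣) (∣⁅x⁆∣≡1 (c j)) ⟩
  suc ∣ imageBelow c j ∣                ≤⟨ s≤s (∣imageBelow∣≤ c j) ⟩
  suc j                                 ∎
  where open ≤-Reasoning

imageBelow-fort : ∀ {G c} → SharedNeighbours G c → ∀ M → c M ∈ imageBelow c M → Fort G (imageBelow c M)
imageBelow-fort {G} {c} shared M returns = (c M , returns) , closed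
  where
  W = imageBelow c M

  consecutive-∈ : ∀ {k i} → k < M → Consecutive k i → c i ∈ W
  consecutive-∈ k<M (inj₁ refl) with m≤n⇒m<n∨m≡n k<M
  ... | inj₁ k+1<M = ∈-imageBelow⁺ c k+1<M
  ... | inj₂ refl  = returns
  consecutive-∈ k<M (inj₂ refl) = ∈-imageBelow⁺ c (<⇒≤ k<M)

  closed : ∀ {u v} → u ∉ W → Adj G u v → v ∈ W → ∃[ w ] (Adj G u w × w ≢ v × w ∈ W)
  closed _ u~v v∈W with ∈-imageBelow⁻ c M v∈W
  ... | k , k<M , refl with shared k u~v
  ...   | i , k~i , u~ci , ci≢ck = c i , u~ci , ci≢ck , consecutive-∈ k<M k~i

F≥-returning : ∀ {G c} → SharedNeighbours G c → ∀ {M k} → k < M → c M ≡ c k → F≥ G (N G ∸ M)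
F≥-returning {G} {c} shared {M} k<M cM≡ck =
  F≥-weaken (∸-monoʳ-≤ (N G) (∣imageBelow∣≤ c M))
    (F≥-fort (imageBelow-fort {G} shared M (subst (_∈ imageBelow c M) (sym cM≡ck) (∈-imageBelow⁺ c k<M))))

Grid : ℕ → ℕ → Graph
Grid a b = P (suc a) □ P (suc b)

billiard : ∀ {a b} → 1 ≤ a → 1 ≤ b → ℕ → Fin (N (Grid a b))
billiard 1≤a 1≤b = diagonal {P _} {P _} (zigzagWalk 1≤a) (zigzagWalk 1≤b)

billiard-shared : ∀ {a b} (1≤a : 1 ≤ a) (1≤b : 1 ≤ b) → SharedNeighbours (Grid a b) (billiard 1≤a 1≤b)
billiard-shared 1≤a 1≤b = diagonal-shared (zigzagWalk-tight 1≤a) (zigzagWalk-tight 1≤b)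

billiard-≡ : ∀ {a b} (1≤a : 1 ≤ a) (1≤b : 1 ≤ b) i j →
             zigzag a i ≡ zigzag a j → zigzag b i ≡ zigzag b j → billiard 1≤a 1≤b i ≡ billiard 1≤a 1≤b j
billiard-≡ 1≤a 1≤b i j rows cols = cong₂ combine (zigzagWalk-≡ 1≤a i j rows) (zigzagWalk-≡ 1≤b i j cols)

-- a = q b: at time a both coordinates sit on a wall, so the trajectory retraces itself.
F≥-grid-divisible : ∀ {a b} → 1 ≤ a → 1 ≤ b → b ∣ a → F≥ (Grid a b) (suc a * suc b ∸ suc a)
F≥-grid-divisible {suc a′} {b} 1≤a 1≤b (divides q a≡qb) =
  F≥-returning (billiard-shared 1≤a 1≤b) {k = a′} (n≤1+n (suc a′))
    (billiard-≡ 1≤a 1≤b (suc (suc a′)) a′ (zigzag-reflects 1≤a 1 a′ (sym (+-identityʳ (suc a′))))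
                        (zigzag-reflects 1≤b q a′ a≡qb))

-- a = b + c: after a + b steps the rows are back at c (one reflection) and the
-- columns at c + 2b ≡ c (one period).
F≥-grid : ∀ {a b} → 1 ≤ b → b ≤ a → F≥ (Grid a b) (suc a * suc b ∸ (a + b))
F≥-grid {a} {suc s} 1≤b b≤a =
  F≥-returning (billiard-shared 1≤a 1≤b) {k = c} c<a+b (billiard-≡ 1≤a 1≤b (a + b) c rows cols)
  where
  b = suc s
  c = a ∸ b
  1≤a = ≤-trans 1≤b b≤a
  a≡b+c : a ≡ b + c
  a≡b+c = sym (m+[n∸m]≡n b≤a)
  c<a+b : c < a + b
  c<a+b = ≤-<-trans (m∸n≤m a b) (m<m+n a 1≤b)
  rows : zigzag a (a + b) ≡ zigzag a c
  rows = trans (zigzag-descending s c a≡b+c) (sym (zigzag-ascending c (m∸n≤m a b)))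
  cols : zigzag b (a + b) ≡ zigzag b c
  cols = trans (cong (zigzag b) a+b≡c+2b) (zigzag-periodic 1≤b c)
    where
    a+b≡c+2b : a + b ≡ c + (b + b)
    a+b≡c+2b = trans (cong (_+ b) (trans a≡b+c (+-comm b c))) (+-assoc c b b)

grid-bound : ∀ {a b} → 1 ≤ a → 1 ≤ b → suc a * suc b ∸ suc a ∸ suc b + 2 ≡ suc a * suc b ∸ (a + b)
grid-bound {a} {b} 1≤a 1≤b = begin
  x ∸ suc a ∸ suc b + 2    ≡⟨ cong (_+ 2) (∸-+-assoc x (suc a) (suc b)) ⟩
  x ∸ (suc a + suc b) + 2  ≡⟨ cong (λ t → x ∸ t + 2) (+-suc-suc a b) ⟩
  x ∸ (a + b + 2) + 2      ≡⟨ cong (_+ 2) (sym (∸-+-assoc x (a + b) 2)) ⟩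
  x ∸ (a + b) ∸ 2 + 2      ≡⟨ m∸n+n≡m (m+n≤o⇒m≤o∸n 2 2+a+b≤x) ⟩
  x ∸ (a + b)              ∎
  where
  open ≡-Reasoning
  x = suc a * suc b

  +-suc-suc : ∀ a b → suc a + suc b ≡ a + b + 2
  +-suc-suc = solve-∀

  expand : ∀ a b → suc a * suc b ≡ 1 + (a + b) + a * b
  expand = solve-∀

  2+a+b≤x : 2 + (a + b) ≤ x
  2+a+b≤x = ≤-trans (≤-reflexive (+-comm 1 (1 + (a + b))))
              (≤-trans (+-monoʳ-≤ (1 + (a + b)) (*-mono-≤ 1≤a 1≤b)) (≤-reflexive (sym (expand a b))))

bound-cases : ∀ n m → (r n m ≡ 0 × bound n m ≡ n * m ∸ n) ⊎ bound n m ≡ n * m ∸ n ∸ m + 2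
bound-cases n m with r n m
... | zero  = inj₁ (refl , refl)
... | suc _ = inj₂ refl

r≡0⇒∣ : ∀ {a b} → 1 ≤ b → b ≤ a → r (suc a) (suc b) ≡ 0 → b ∣ a
r≡0⇒∣ {a} {suc b′} _ b≤a r≡0 with suc a ≟ suc (suc b′)
... | yes n≡m = ∣-reflexive (sym (suc-injective n≡m))
... | no _    = ∣m∸n∣n⇒∣m (suc b′) b≤a (m%n≡0⇒n∣m (a ∸ suc b′) (suc b′) r≡0) ∣-refl

corollary3p3 : (n m : ℕ) → 2 ≤ m → m ≤ n → F≥ (P n □ P m) (bound n m)
corollary3p3 (suc a) (suc b) (s≤s 1≤b) (s≤s b≤a) with bound-cases (suc a) (suc b)
... | inj₁ (r≡0 , bound≡) =
  subst (F≥ (Grid a b)) (sym bound≡) (F≥-grid-divisible 1≤a 1≤b (r≡0⇒∣ 1≤b b≤a r≡0))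
  where 1≤a = ≤-trans 1≤b b≤a
... | inj₂ bound≡ =
  subst (F≥ (Grid a b)) (sym (trans bound≡ (grid-bound 1≤a 1≤b))) (F≥-grid 1≤b b≤a)
  where 1≤a = ≤-trans 1≤b b≤a
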